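{- Let $\alpha$ be a non-degenerate $N$-simplex whose vertices are vertices of a simplotope $\Pi(c_1,\dots,c_n)$, $N=c_1+\cdots+c_n$. Then the class of any exterior face of $\alpha$ divides the class of $\alpha$. Furthermore, the class of any exterior facet (exterior face of dimension $N-1$) of $\alpha$ equals the class of $\alpha$.
   Context: $\Pi(c_1,\dots,c_n)=\Delta^{c_1}\times\cdots\times\Delta^{c_n}$ in standard coordinates $(\mathbf x^1;\dots;\mathbf x^n)$, $\mathbf x^i=(x^i_1,\dots,x^i_{c_i+1})\in\Delta^{c_i}$; vertices are the $0/1$ points. Reduced coordinates with respect to a vertex $\mathbf v$: delete in each factor the coordinate at which $\mathbf v$ is $1$. The class of an $N$-simplex with vertex set among simplotope vertices is $|\det[\mathbf 1\mid M_{\mathbf v}]|$, where the rows of $M_{\mathbf v}$ are the reduced coordinates of its vertices; non-degenerate means class $\neq0$. A $k$-simplex whose vertices are vertices of a $k$-dimensional face $G$ of the simplotope (itself a simplotope) has class computed in the same way inside $G$. An exterior $j$-face of $\alpha$ is a $j$-dimensional face of $\alpha$ whose $j+1$ vertices lie in a common $j$-dimensional face of the simplotope. -}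

module Defs where

open import Data.Nat using (ℕ; zero; suc; _+_)
open import Data.Integer using (ℤ; +_; _*_; -_) renaming (_+_ to _+ℤ_)
open import Data.Fin using (Fin; zero; suc; splitAt; punchIn; toℕ; _≟_)
open import Data.Vec using (Vec; []; _∷_; lookup; sum)
open import Data.Sum using (inj₁; inj₂)
open import Data.Bool using (if_then_else_)
open import Relation.Nullary using (does; ¬_)
open import Relation.Binary.PropositionalEquality using (_≡_)
open import Function.Definitions using (Injective)

sumFin : ∀ {m} → (Fin m → ℤ) → ℤ
sumFin {zero}  f = + 0
sumFin {suc m} f = f zero +ℤ sumFin (λ j → f (suc j))

sgn : ℕ → ℤ
sgn zero    = + 1
sgn (suc k) = - sgn k

det : ∀ {m} → (Fin m → Fin m → ℤ) → ℤ
det {zero}  A = + 1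
det {suc m} A =
  sumFin (λ j → sgn (toℕ j) * (A zero j * det (λ r k → A (suc r) (punchIn j k))))

-- A vertex of the simplotope Π(c₁,…,cₙ) = Δ^{c₁} × ⋯ × Δ^{cₙ}:
-- in each factor i, the index of the coordinate of x^i equal to 1.
Vertex : ∀ {n} → Vec ℕ n → Set
Vertex {n} c = (i : Fin n) → Fin (suc (lookup c i))

-- Reduced coordinates with respect to the reference vertex v₀ whose i-th factor
-- is the first vertex of Δ^{cᵢ}: in each factor, delete the coordinate x^i₁.
-- The remaining coordinates x^i₂,…,x^i_{cᵢ+1} of all factors are concatenated,
-- giving a vector of length N = c₁ + ⋯ + cₙ.
reduced : ∀ {n} (c : Vec ℕ n) → Vertex c → Fin (sum c) → ℤ
reduced []       v ()
reduced (c₀ ∷ c) v k with splitAt c₀ k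
... | inj₁ j = if does (v zero ≟ suc j) then + 1 else + 0
... | inj₂ k′ = reduced c (λ i → v (suc i)) k′

Simplex : ∀ {n} → Vec ℕ n → Set
Simplex c = Fin (suc (sum c)) → Vertex c

classMatrix : ∀ {n} (c : Vec ℕ n) → Simplex c → Fin (suc (sum c)) → Fin (suc (sum c)) → ℤ
classMatrix c α r zero    = + 1
classMatrix c α r (suc k) = reduced c (α r) k

class : ∀ {n} (c : Vec ℕ n) → Simplex c → ℕ
class c α = Data.Integer.∣ det (classMatrix c α) ∣

NonDegenerate : ∀ {n} (c : Vec ℕ n) → Simplex c → Set
NonDegenerate c α = ¬ (class c α ≡ 0)

-- A face G of Π(c) is a product of faces of the factors; the face of Δ^{cᵢ}
-- spanned by dᵢ+1 of its vertices is given by an injection Fin (dᵢ+1) → Fin (cᵢ+1).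
-- G is then identified with the simplotope Π(d₁,…,dₙ), of dimension sum d.
record FaceEmbedding {n} (d c : Vec ℕ n) : Set where
  field
    emb : (i : Fin n) → Fin (suc (lookup d i)) → Fin (suc (lookup c i))
    emb-injective : ∀ i {x y} → emb i x ≡ emb i y → x ≡ y

-- The exterior-face data: β (a simplex of the face G ≅ Π(d), of dimension
-- j = sum d) is the face of α spanned by the j+1 vertices α (f 0), …, α (f j)
-- (f injective), and these vertices lie in the j-dimensional face G of Π(c).
-- The class of this exterior face is class d β (computed inside G).
record IsExteriorFace {n} (c : Vec ℕ n) (α : Simplex c)
                      (d : Vec ℕ n) (G : FaceEmbedding d c)
                      (f : Fin (suc (sum d)) → Fin (suc (sum c)))
                      (β : Simplex d) : Set where
  field
    f-injective : Injective _≡_ _≡_ f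
    vertices-agree : ∀ r i → FaceEmbedding.emb G i (β r i) ≡ α (f r) i

module Submission where

-- Let α be an N-simplex with vertices among those of Π(c) = Δ^{c₁} × ⋯ × Δ^{cₙ} and let
-- β be an exterior face of α lying in the face G ≅ Π(d) of Π(c).  Take as reference
-- vertex the first vertex of G in every factor.  In the class matrix [1 | M] of α the rows
-- of the vertices of β then vanish outside the columns belonging to G (the column of ones
-- and the reduced coordinates of G), and on those columns they form the class matrix of β.
-- Permuting rows and columns makes the matrix block lower-triangular, so
-- class α = class β · |det D| for a square 0/1 matrix D of size N − dim β.  Hence class β
-- divides class α, and for a facet D is 1 × 1, so |det D| = 1 since α is non-degenerate.

open import Defs
open import Data.Nat using (ℕ; zero; suc; _≤_; z≤n; _<?_) renaming (_+_ to _+ℕ_; _*_ to _*ℕ_)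
import Data.Nat.Properties as ℕP
open import Data.Nat.Divisibility using (_∣_; divides)
open import Data.Integer using (ℤ; +_; -_; _+_; _-_; _*_; ∣_∣; +[1+_]; -[1+_])
import Data.Integer.Properties as ℤP
open import Data.Integer.Tactic.RingSolver using (solve-∀)
open import Data.Fin using (Fin; zero; suc; punchIn; punchOut; toℕ; fromℕ<; _↑ˡ_; _↑ʳ_; splitAt; _≟_)
open import Data.Fin.Properties
  using (suc-injective; 0≢1+n; toℕ-↑ˡ; ↑ˡ-injective; ↑ʳ-injective; splitAt-↑ˡ; splitAt-↑ʳ;
         punchIn-punchOut; punchInᵢ≢i; punchIn-injective; punchOut-injective; injective⇒≤;
         toℕ-injective; toℕ-fromℕ<; toℕ<n)
open import Data.Vec using (Vec; _∷_; lookup; sum)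
open import Data.Bool using (true; false; if_then_else_)
open import Data.Sum using (_⊎_; inj₁; inj₂)
open import Data.Product using (Σ; _,_; ∃₂; _×_)
open import Data.Empty using (⊥-elim)
open import Function.Definitions using (Injective)
open import Relation.Nullary using (does; yes; no)
open import Relation.Nullary.Decidable using (dec-true; dec-false)
open import Relation.Binary.PropositionalEquality

sumFin-cong : ∀ {m} {f g : Fin m → ℤ} → (∀ i → f i ≡ g i) → sumFin f ≡ sumFin g
sumFin-cong {zero}  f≗g = refl
sumFin-cong {suc m} f≗g = cong₂ _+_ (f≗g zero) (sumFin-cong (λ i → f≗g (suc i)))

sumFin-zero : ∀ {m} (f : Fin m → ℤ) → (∀ i → f i ≡ + 0) → sumFin f ≡ + 0
sumFin-zero {zero}  f f≗0 = refl
sumFin-zero {suc m} f f≗0 = cong₂ _+_ (f≗0 zero) (sumFin-zero _ (λ i → f≗0 (suc i)))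

sumFin-+ : ∀ {m} (f g : Fin m → ℤ) → sumFin (λ i → f i + g i) ≡ sumFin f + sumFin g
sumFin-+ {zero}  f g = refl
sumFin-+ {suc m} f g =
  trans (cong (_+_ (f zero + g zero)) (sumFin-+ (λ i → f (suc i)) (λ i → g (suc i))))
        (interchange (f zero) (g zero) _ _)
  where
  interchange : ∀ a b c d → (a + b) + (c + d) ≡ (a + c) + (b + d)
  interchange = solve-∀

sumFin-scale : ∀ {m} (k : ℤ) (f : Fin m → ℤ) → k * sumFin f ≡ sumFin (λ i → k * f i)
sumFin-scale {zero}  k f = ℤP.*-zeroʳ k
sumFin-scale {suc m} k f =
  trans (ℤP.*-distribˡ-+ k (f zero) _) (cong (_+_ (k * f zero)) (sumFin-scale k (λ i → f (suc i))))

sumFin-swap : ∀ {m k} (F : Fin m → Fin k → ℤ) →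
  sumFin (λ i → sumFin (F i)) ≡ sumFin (λ j → sumFin (λ i → F i j))
sumFin-swap {zero}  F = sym (sumFin-zero (λ j → sumFin (λ i → F i j)) (λ _ → refl))
sumFin-swap {suc m} F = begin
  sumFin (F zero) + sumFin (λ i → sumFin (F (suc i)))
    ≡⟨ cong (_+_ (sumFin (F zero))) (sumFin-swap (λ i → F (suc i))) ⟩
  sumFin (F zero) + sumFin (λ j → sumFin (λ i → F (suc i) j))
    ≡⟨ sym (sumFin-+ (F zero) _) ⟩
  sumFin (λ j → F zero j + sumFin (λ i → F (suc i) j)) ∎
  where open ≡-Reasoning

sumFin-split : ∀ k {l} (f : Fin (k +ℕ l) → ℤ) →
  sumFin f ≡ sumFin (λ i → f (i ↑ˡ l)) + sumFin (λ j → f (k ↑ʳ j))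
sumFin-split zero    f = sym (ℤP.+-identityˡ _)
sumFin-split (suc k) f =
  trans (cong (_+_ (f zero)) (sumFin-split k (λ i → f (suc i)))) (sym (ℤP.+-assoc (f zero) _ _))

sumFin-single : ∀ {m} (f : Fin m → ℤ) (u : Fin m) → (∀ i → i ≢ u → f i ≡ + 0) → sumFin f ≡ f u
sumFin-single f zero f≗0 =
  trans (cong (_+_ (f zero)) (sumFin-zero _ (λ i → f≗0 (suc i) λ ()))) (ℤP.+-identityʳ _)
sumFin-single f (suc u) f≗0 =
  trans (cong₂ _+_ (f≗0 zero λ ())
                   (sumFin-single (λ i → f (suc i)) u (λ i i≢u → f≗0 (suc i) (λ e → i≢u (suc-injective e)))))
        (ℤP.+-identityˡ _)

sumFin-neg : ∀ {m} (f : Fin m → ℤ) → sumFin (λ i → - f i) ≡ - sumFin f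
sumFin-neg {zero}  f = refl
sumFin-neg {suc m} f =
  trans (cong (_+_ (- f zero)) (sumFin-neg (λ i → f (suc i)))) (sym (ℤP.neg-distrib-+ (f zero) _))

sumFin-scale₂ : ∀ {m} (s a : ℤ) (f : Fin m → ℤ) → s * (a * sumFin f) ≡ sumFin (λ i → s * (a * f i))
sumFin-scale₂ s a f = trans (cong (s *_) (sumFin-scale a f)) (sumFin-scale s (λ i → a * f i))

Matrix : ℕ → Set
Matrix m = Fin m → Fin m → ℤ

minor : ∀ {m} → Matrix (suc m) → Fin (suc m) → Matrix m
minor A j r k = A (suc r) (punchIn j k)

expansionTerm : ∀ {m} → Matrix (suc m) → Fin (suc m) → ℤ
expansionTerm A j = sgn (toℕ j) * (A zero j * det (minor A j))

columnMinor : ∀ {m} → Matrix (suc m) → Fin (suc m) → Matrix m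
columnMinor A i r k = A (punchIn i r) (suc k)

columnTerm : ∀ {m} → Matrix (suc m) → Fin (suc m) → ℤ
columnTerm A i = sgn (toℕ i) * (A i zero * det (columnMinor A i))

det-cong : ∀ {m} {A B : Matrix m} → (∀ i j → A i j ≡ B i j) → det A ≡ det B
det-cong {zero}  A≗B = refl
det-cong {suc m} A≗B = sumFin-cong λ j →
  cong₂ (λ x y → sgn (toℕ j) * (x * y)) (A≗B zero j) (det-cong (λ r k → A≗B (suc r) (punchIn j k)))

sgn-unit : ∀ n → ∣ sgn n ∣ ≡ 1
sgn-unit zero    = refl
sgn-unit (suc n) = trans (ℤP.∣-i∣≡∣i∣ (sgn n)) (sgn-unit n)

-- Laplace expansion along column 0: expand every minor of the row expansion
-- along its first column and exchange the two sums.
det-columnExpansion : ∀ {m} (A : Matrix (suc m)) → det A ≡ sumFin (columnTerm A)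
det-columnExpansion {zero}  A = refl
det-columnExpansion {suc m} A = cong (_+_ (expansionTerm A zero)) (begin
  sumFin (λ j → expansionTerm A (suc j))    ≡⟨ sumFin-cong expandRowTerm ⟩
  sumFin (λ j → sumFin (λ i → T i j))       ≡⟨ sym (sumFin-swap T) ⟩
  sumFin (λ i → sumFin (λ j → T i j))       ≡⟨ sumFin-cong (λ i → sym (expandColumnTerm i)) ⟩
  sumFin (λ i → columnTerm A (suc i))       ∎)
  where
  open ≡-Reasoning
  X : Fin (suc m) → Fin (suc m) → ℤ
  X i j = det (λ r k → A (suc (punchIn i r)) (suc (punchIn j k)))
  T : Fin (suc m) → Fin (suc m) → ℤ
  T i j = - sgn (toℕ j) * (sgn (toℕ i) * (A zero (suc j) * (A (suc i) zero * X i j)))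
  reorder₁ : ∀ s a t b x → s * (a * (t * (b * x))) ≡ s * (t * (a * (b * x)))
  reorder₁ = solve-∀
  reorder₂ : ∀ s a t b x → - t * (b * (s * (a * x))) ≡ - s * (t * (a * (b * x)))
  reorder₂ = solve-∀
  expandRowTerm : ∀ j → expansionTerm A (suc j) ≡ sumFin (λ i → T i j)
  expandRowTerm j = begin
    expansionTerm A (suc j)
      ≡⟨ cong (λ z → - sgn (toℕ j) * (A zero (suc j) * z)) (det-columnExpansion (minor A (suc j))) ⟩
    - sgn (toℕ j) * (A zero (suc j) * sumFin (λ i → sgn (toℕ i) * (A (suc i) zero * X i j)))
      ≡⟨ sumFin-scale₂ (- sgn (toℕ j)) (A zero (suc j)) (λ i → sgn (toℕ i) * (A (suc i) zero * X i j)) ⟩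
    sumFin (λ i → - sgn (toℕ j) * (A zero (suc j) * (sgn (toℕ i) * (A (suc i) zero * X i j))))
      ≡⟨ sumFin-cong (λ i →
           reorder₁ (- sgn (toℕ j)) (A zero (suc j)) (sgn (toℕ i)) (A (suc i) zero) (X i j)) ⟩
    sumFin (λ i → T i j) ∎
  expandColumnTerm : ∀ i → columnTerm A (suc i) ≡ sumFin (λ j → T i j)
  expandColumnTerm i = begin
    - sgn (toℕ i) * (A (suc i) zero * sumFin (λ j → sgn (toℕ j) * (A zero (suc j) * X i j)))
      ≡⟨ sumFin-scale₂ (- sgn (toℕ i)) (A (suc i) zero) (λ j → sgn (toℕ j) * (A zero (suc j) * X i j)) ⟩
    sumFin (λ j → - sgn (toℕ i) * (A (suc i) zero * (sgn (toℕ j) * (A zero (suc j) * X i j))))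
      ≡⟨ sumFin-cong (λ j → reorder₂ (sgn (toℕ j)) (A zero (suc j)) (sgn (toℕ i)) (A (suc i) zero) (X i j)) ⟩
    sumFin (λ j → T i j) ∎

-- Transposition: the column expansion of A is the row expansion of its transpose.
det-transpose : ∀ {m} (A : Matrix m) → det (λ i j → A j i) ≡ det A
det-transpose {zero}  A = refl
det-transpose {suc m} A =
  trans (sumFin-cong (λ i → cong (λ z → sgn (toℕ i) * (A i zero * z)) (det-transpose (columnMinor A i))))
        (sym (det-columnExpansion A))

swap01 : ∀ {m} → Fin (suc (suc m)) → Fin (suc (suc m))
swap01 zero          = suc zero
swap01 (suc zero)    = zero
swap01 (suc (suc i)) = suc (suc i)

-- Exchanging the first two rows negates the determinant (expansion along column 0:
-- the terms of rows 0 and 1 are exchanged with a sign, the others change sign by induction).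
det-swap01 : ∀ {m} (A : Matrix (suc (suc m))) → det (λ i j → A (swap01 i) j) ≡ - det A
det-swap01 {m} A = begin
  det B                                           ≡⟨ det-columnExpansion B ⟩
  term0 B + (term1 B + sumFin (λ i → later B i))
    ≡⟨ cong₂ _+_ swapped0 (cong₂ _+_ swapped1 (laterTerms m A)) ⟩
  - term1 A + (- term0 A + - sumFin (λ i → later A i))
    ≡⟨ regroup (term0 A) (term1 A) _ ⟩
  - (term0 A + (term1 A + sumFin (λ i → later A i))) ≡⟨ cong -_ (sym (det-columnExpansion A)) ⟩
  - det A ∎
  where
  open ≡-Reasoning
  B : Matrix (suc (suc m))
  B i j = A (swap01 i) j
  term0 term1 : Matrix (suc (suc m)) → ℤ
  term0 M = columnTerm M zero
  term1 M = columnTerm M (suc zero)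
  later : Matrix (suc (suc m)) → Fin m → ℤ
  later M i = columnTerm M (suc (suc i))
  regroup : ∀ a b c → - b + (- a + - c) ≡ - (a + (b + c))
  regroup = solve-∀
  swapped0 : term0 B ≡ - term1 A
  swapped0 = trans (cong (λ z → + 1 * (A (suc zero) zero * z))
                         (det-cong {A = columnMinor B zero} {B = columnMinor A (suc zero)}
                                   λ { zero k → refl ; (suc r) k → refl }))
                   (flip (A (suc zero) zero) _)
    where flip : ∀ a d → + 1 * (a * d) ≡ - (- (+ 1) * (a * d))
          flip = solve-∀
  swapped1 : term1 B ≡ - term0 A
  swapped1 = trans (cong (λ z → - (+ 1) * (A zero zero * z))
                         (det-cong {A = columnMinor B (suc zero)} {B = columnMinor A zero}
                                   λ { zero k → refl ; (suc r) k → refl }))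
                   (flip (A zero zero) _)
    where flip : ∀ a d → - (+ 1) * (a * d) ≡ - (+ 1 * (a * d))
          flip = solve-∀
  laterTerms : ∀ m′ (M : Matrix (suc (suc m′))) →
    sumFin (λ i → columnTerm (λ r j → M (swap01 r) j) (suc (suc i))) ≡ - sumFin (λ i → columnTerm M (suc (suc i)))
  laterTerms zero     M = refl
  laterTerms (suc m′) M = trans (sumFin-cong negated) (sumFin-neg (λ i → columnTerm M (suc (suc i))))
    where
    negated : ∀ i → columnTerm (λ r j → M (swap01 r) j) (suc (suc i)) ≡ - columnTerm M (suc (suc i))
    negated i =
      trans (cong (λ z → sgn (toℕ (suc (suc i))) * (M (suc (suc i)) zero * z))
                  (trans (det-cong {A = columnMinor (λ r j → M (swap01 r) j) (suc (suc i))}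
                                   {B = λ r k → columnMinor M (suc (suc i)) (swap01 r) k}
                                   λ { zero k → refl ; (suc zero) k → refl ; (suc (suc r)) k → refl })
                         (det-swap01 (columnMinor M (suc (suc i))))))
            (pullNeg (sgn (toℕ (suc (suc i)))) (M (suc (suc i)) zero) _)
      where pullNeg : ∀ s a d → s * (a * - d) ≡ - (s * (a * d))
            pullNeg = solve-∀

i≡-i⇒i≡0 : ∀ {i : ℤ} → i ≡ - i → i ≡ + 0
i≡-i⇒i≡0 {+ zero}   _ = refl
i≡-i⇒i≡0 {+[1+ n ]} ()
i≡-i⇒i≡0 { -[1+ n ]} ()

-- Two equal leading rows: det A = − det A, so det A = 0.
det-equalRows01 : ∀ {m} (A : Matrix (suc (suc m))) → (∀ j → A zero j ≡ A (suc zero) j) → det A ≡ + 0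
det-equalRows01 A row0≡row1 = i≡-i⇒i≡0 (trans (det-cong swapped≗A) (det-swap01 A))
  where
  swapped≗A : ∀ i j → A i j ≡ A (swap01 i) j
  swapped≗A zero          j = row0≡row1 j
  swapped≗A (suc zero)    j = sym (row0≡row1 j)
  swapped≗A (suc (suc i)) j = refl

record RowPermutation {m} (σ : Fin m → Fin m) : Set where
  field
    factor         : ℤ
    factor-unit    : ∣ factor ∣ ≡ 1
    det-permute    : ∀ A → det (λ i j → A (σ i) j) ≡ factor * det A
    rows-injective : Injective _≡_ _≡_ σ

abs-unit : ∀ (s x : ℤ) → ∣ s ∣ ≡ 1 → ∣ s * x ∣ ≡ ∣ x ∣
abs-unit s x ∣s∣≡1 = trans (ℤP.abs-* s x) (trans (cong (_*ℕ ∣ x ∣) ∣s∣≡1) (ℕP.*-identityˡ ∣ x ∣))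

∣det-permute∣ : ∀ {m} {σ : Fin m → Fin m} → RowPermutation σ → ∀ A →
  ∣ det (λ i j → A (σ i) j) ∣ ≡ ∣ det A ∣
∣det-permute∣ π A = trans (cong ∣_∣ (det-permute A)) (abs-unit factor (det A) factor-unit)
  where open RowPermutation π

_∘ᴿ_ : ∀ {m} {σ τ : Fin m → Fin m} → RowPermutation σ → RowPermutation τ →
  RowPermutation (λ i → σ (τ i))
_∘ᴿ_ {σ = σ} {τ} π ρ = record
  { factor      = R.factor * P.factor
  ; factor-unit = trans (ℤP.abs-* R.factor P.factor) (cong₂ _*ℕ_ R.factor-unit P.factor-unit)
  ; det-permute = λ A → trans (permuteByτ A) (trans (cong (R.factor *_) (P.det-permute A))
                                                   (sym (ℤP.*-assoc R.factor P.factor (det A))))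
  ; rows-injective = λ e → R.rows-injective (P.rows-injective e)
  }
  where
  module P = RowPermutation π
  module R = RowPermutation ρ
  permuteByτ : ∀ A → det (λ i j → A (σ (τ i)) j) ≡ R.factor * det (λ i j → A (σ i) j)
  permuteByτ A = R.det-permute (λ i j → A (σ i) j)

liftFin : ∀ {m} → (Fin m → Fin m) → Fin (suc m) → Fin (suc m)
liftFin σ zero    = zero
liftFin σ (suc i) = suc (σ i)

-- Expanding along row 0, a uniform factor of σ comes out of every minor.
det-permuteTail : ∀ {m} (σ : Fin m → Fin m) (s : ℤ) → (∀ B → det (λ i j → B (σ i) j) ≡ s * det B) →
  ∀ A → det (λ i j → A (liftFin σ i) j) ≡ s * det A
det-permuteTail σ s det-σ A =
  trans (sumFin-cong λ j →
           trans (cong (λ z → sgn (toℕ j) * (A zero j * z)) (det-σ (minor A j)))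
                 (reorder (sgn (toℕ j)) (A zero j) s _))
        (sym (sumFin-scale s (expansionTerm A)))
  where
  reorder : ∀ g a s d → g * (a * (s * d)) ≡ s * (g * (a * d))
  reorder = solve-∀

lift-rowPermutation : ∀ {m} {σ : Fin m → Fin m} → RowPermutation σ → RowPermutation (liftFin σ)
lift-rowPermutation {σ = σ} π = record
  { factor         = factor
  ; factor-unit    = factor-unit
  ; det-permute    = det-permuteTail σ factor det-permute
  ; rows-injective = lift-injective
  }
  where
  open RowPermutation π
  lift-injective : Injective _≡_ _≡_ (liftFin σ)
  lift-injective {zero}  {zero}  _ = refl
  lift-injective {suc x} {suc y} e = cong suc (rows-injective (suc-injective e))

toTop : ∀ {m} → Fin (suc m) → Fin (suc m) → Fin (suc m)
toTop r zero    = r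
toTop r (suc i) = punchIn r i

toTop-injective : ∀ {m} (r : Fin (suc m)) → Injective _≡_ _≡_ (toTop r)
toTop-injective r {zero}  {zero}  _ = refl
toTop-injective r {zero}  {suc y} e = ⊥-elim (punchInᵢ≢i r y (sym e))
toTop-injective r {suc x} {zero}  e = ⊥-elim (punchInᵢ≢i r x e)
toTop-injective r {suc x} {suc y} e = cong suc (punchIn-injective r x y e)

-- toTop is a cycle of sign (-1)^r: toTop (r+1) permutes rows like swap01 after liftFin (toTop r).
det-toTop : ∀ {m} (r : Fin (suc m)) A → det (λ i j → A (toTop r i) j) ≡ sgn (toℕ r) * det A
det-toTop zero    A =
  trans (det-cong {A = λ i j → A (toTop zero i) j} {B = A} λ { zero j → refl ; (suc i) j → refl })
        (sym (ℤP.*-identityˡ (det A)))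
det-toTop {suc m} (suc r) A =
  trans (det-cong {A = λ i j → A (toTop (suc r) i) j} {B = λ i j → C (swap01 i) j}
                  λ { zero j → refl ; (suc zero) j → refl ; (suc (suc i)) j → refl })
  (trans (det-swap01 C)
  (trans (cong -_ (det-permuteTail (toTop r) (sgn (toℕ r)) (det-toTop r) A))
         (ℤP.neg-distribˡ-* (sgn (toℕ r)) (det A))))
  where
  C : Matrix (suc (suc m))
  C i j = A (liftFin (toTop r) i) j

toTop-rowPermutation : ∀ {m} (r : Fin (suc m)) → RowPermutation (toTop r)
toTop-rowPermutation r = record
  { factor = sgn (toℕ r) ; factor-unit = sgn-unit (toℕ r)
  ; det-permute = det-toTop r ; rows-injective = toTop-injective r }

id-rowPermutation : ∀ {m} → RowPermutation {m} (λ i → i)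
id-rowPermutation = record
  { factor = + 1 ; factor-unit = refl
  ; det-permute = λ A → sym (ℤP.*-identityˡ (det A)) ; rows-injective = λ e → e }

record Extension {k l} (g : Fin k → Fin (k +ℕ l)) : Set where
  field
    σ             : Fin (k +ℕ l) → Fin (k +ℕ l)
    σ-permutation : RowPermutation σ
    σ-extends     : ∀ i → σ (i ↑ˡ l) ≡ g i

-- Every injection Fin k → Fin (k + l) extends to a row permutation: move g(0) to the top,
-- then extend the injection obtained by punching g(0) out of the remaining values.
extend : ∀ {k l} (g : Fin k → Fin (k +ℕ l)) → Injective _≡_ _≡_ g → Extension g
extend {zero}      g g-inj = record { σ = λ i → i ; σ-permutation = id-rowPermutation ; σ-extends = λ () }
extend {suc k} {l} g g-inj = record
  { σ             = λ i → toTop (g zero) (liftFin E.σ i)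
  ; σ-permutation = toTop-rowPermutation (g zero) ∘ᴿ lift-rowPermutation E.σ-permutation
  ; σ-extends     = extends
  }
  where
  g₀≢g₊ : ∀ i → g zero ≢ g (suc i)
  g₀≢g₊ i e = 0≢1+n (g-inj e)
  rest : Fin k → Fin (k +ℕ l)
  rest i = punchOut (g₀≢g₊ i)
  rest-injective : Injective _≡_ _≡_ rest
  rest-injective e = suc-injective (g-inj (punchOut-injective (g₀≢g₊ _) (g₀≢g₊ _) e))
  module E = Extension (extend rest rest-injective)
  extends : ∀ i → toTop (g zero) (liftFin E.σ (i ↑ˡ l)) ≡ g i
  extends zero    = refl
  extends (suc i) = trans (cong (punchIn (g zero)) (E.σ-extends i)) (punchIn-punchOut (g₀≢g₊ i))

det-equalRows : ∀ {m} (A : Matrix m) (p q : Fin m) → p ≢ q → (∀ j → A p j ≡ A q j) → det A ≡ + 0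
det-equalRows {suc zero}    A zero zero p≢q _ = ⊥-elim (p≢q refl)
det-equalRows {suc (suc l)} A p q p≢q rowp≡rowq =
  ℤP.∣i∣≡0⇒i≡0 (trans (sym (∣det-permute∣ σ-permutation A))
                     (cong ∣_∣ (det-equalRows01 (λ i j → A (σ i) j) firstRowsEqual)))
  where
  pq : Fin 2 → Fin (2 +ℕ l)
  pq zero       = p
  pq (suc zero) = q
  pq-injective : Injective _≡_ _≡_ pq
  pq-injective {zero}     {zero}     _ = refl
  pq-injective {zero}     {suc zero} e = ⊥-elim (p≢q e)
  pq-injective {suc zero} {zero}     e = ⊥-elim (p≢q (sym e))
  pq-injective {suc zero} {suc zero} _ = refl
  open Extension (extend pq pq-injective)
  firstRowsEqual : ∀ j → A (σ zero) j ≡ A (σ (suc zero)) j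
  firstRowsEqual j = trans (cong (λ r → A r j) (σ-extends zero))
                     (trans (rowp≡rowq j) (cong (λ r → A r j) (sym (σ-extends (suc zero)))))

det-combination : ∀ {m K} (A : Matrix (suc m)) (B : Fin K → Matrix (suc m)) (w : Fin K → ℤ) →
  (∀ j → expansionTerm A j ≡ sumFin (λ u → w u * expansionTerm (B u) j)) →
  det A ≡ sumFin (λ u → w u * det (B u))
det-combination A B w terms = begin
  sumFin (expansionTerm A)                                   ≡⟨ sumFin-cong terms ⟩
  sumFin (λ j → sumFin (λ u → w u * expansionTerm (B u) j))
    ≡⟨ sumFin-swap (λ j u → w u * expansionTerm (B u) j) ⟩
  sumFin (λ u → sumFin (λ j → w u * expansionTerm (B u) j))
    ≡⟨ sumFin-cong (λ u → sym (sumFin-scale (w u) (expansionTerm (B u)))) ⟩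
  sumFin (λ u → w u * det (B u)) ∎
  where open ≡-Reasoning

det-linearInRow : ∀ {m K} (p : Fin (suc m)) (A : Matrix (suc m)) (B : Fin K → Matrix (suc m)) (w : Fin K → ℤ) →
  (∀ u i j → B u (punchIn p i) j ≡ A (punchIn p i) j) →
  (∀ j → A p j ≡ sumFin (λ u → w u * B u p j)) →
  det A ≡ sumFin (λ u → w u * det (B u))
det-linearInRow zero A B w others rowp = det-combination A B w λ j → begin
  sgn (toℕ j) * (A zero j * det (minor A j))
    ≡⟨ cong (λ a → sgn (toℕ j) * (a * det (minor A j))) (rowp j) ⟩
  sgn (toℕ j) * (sumFin (λ u → w u * B u zero j) * det (minor A j))
    ≡⟨ reorder₁ (sgn (toℕ j)) _ (det (minor A j)) ⟩
  (sgn (toℕ j) * det (minor A j)) * sumFin (λ u → w u * B u zero j)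
    ≡⟨ sumFin-scale (sgn (toℕ j) * det (minor A j)) (λ u → w u * B u zero j) ⟩
  sumFin (λ u → (sgn (toℕ j) * det (minor A j)) * (w u * B u zero j))
    ≡⟨ sumFin-cong (λ u → trans (reorder₂ (sgn (toℕ j)) (det (minor A j)) (w u) (B u zero j))
         (cong (λ d → w u * (sgn (toℕ j) * (B u zero j * d)))
               (det-cong (λ r k → sym (others u r (punchIn j k)))))) ⟩
  sumFin (λ u → w u * expansionTerm (B u) j) ∎
  where
  open ≡-Reasoning
  reorder₁ : ∀ s a d → s * (a * d) ≡ (s * d) * a
  reorder₁ = solve-∀
  reorder₂ : ∀ s d w b → (s * d) * (w * b) ≡ w * (s * (b * d))
  reorder₂ = solve-∀
det-linearInRow {suc m} (suc p) A B w others rowp = det-combination A B w λ j → begin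
  sgn (toℕ j) * (A zero j * det (minor A j))
    ≡⟨ cong (λ d → sgn (toℕ j) * (A zero j * d))
         (det-linearInRow p (minor A j) (λ u → minor (B u) j) w
           (λ u i k → others u (suc i) (punchIn j k)) (λ k → rowp (punchIn j k))) ⟩
  sgn (toℕ j) * (A zero j * sumFin (λ u → w u * det (minor (B u) j)))
    ≡⟨ sumFin-scale₂ (sgn (toℕ j)) (A zero j) (λ u → w u * det (minor (B u) j)) ⟩
  sumFin (λ u → sgn (toℕ j) * (A zero j * (w u * det (minor (B u) j))))
    ≡⟨ sumFin-cong (λ u → trans (reorder (sgn (toℕ j)) (A zero j) (w u) (det (minor (B u) j)))
         (cong (λ a → w u * (sgn (toℕ j) * (a * det (minor (B u) j)))) (sym (others u zero j)))) ⟩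
  sumFin (λ u → w u * expansionTerm (B u) j) ∎
  where
  open ≡-Reasoning
  reorder : ∀ s a w d → s * (a * (w * d)) ≡ w * (s * (a * d))
  reorder = solve-∀

replaceRow : ∀ {m} → Matrix m → Fin m → (Fin m → ℤ) → Matrix m
replaceRow A p v i j with i ≟ p
... | yes _ = v j
... | no  _ = A i j

replaceRow-at : ∀ {m} (A : Matrix m) p v j → replaceRow A p v p j ≡ v j
replaceRow-at A p v j with p ≟ p
... | yes _   = refl
... | no  p≢p = ⊥-elim (p≢p refl)

replaceRow-off : ∀ {m} (A : Matrix m) p v {i} → i ≢ p → ∀ j → replaceRow A p v i j ≡ A i j
replaceRow-off A p v {i} i≢p j with i ≟ p
... | yes i≡p = ⊥-elim (i≢p i≡p)
... | no  _   = refl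

-- Replacing row p = g b of A by (row z) − Σ_s (row g s), with g injective and z ≠ p,
-- negates the determinant: by linearity only the term s = b survives, all others
-- have two equal rows.
det-replaceRow : ∀ {m K} (A B : Matrix (suc m)) (p z : Fin (suc m)) (g : Fin K → Fin (suc m)) (b : Fin K) →
  Injective _≡_ _≡_ g → g b ≡ p → z ≢ p →
  (∀ i → i ≢ p → ∀ j → B i j ≡ A i j) → (∀ j → B p j ≡ A z j - sumFin (λ s → A (g s) j)) →
  det B ≡ - det A
det-replaceRow {m} {K} A B p z g b g-inj gb≡p z≢p others rowp = begin
  det B                                 ≡⟨ det-linearInRow p B C w replacedOthers replacedRow ⟩
  sumFin (λ u → w u * det (C u))        ≡⟨ sumFin-single (λ u → w u * det (C u)) (suc b) vanishing ⟩
  - (+ 1) * det (C (suc b))             ≡⟨ cong (λ d → - (+ 1) * d) (det-cong (λ i j → restored i j)) ⟩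
  - (+ 1) * det A                       ≡⟨ ℤP.-1*i≡-i (det A) ⟩
  - det A ∎
  where
  open ≡-Reasoning
  source : Fin (suc K) → Fin (suc m)
  source zero    = z
  source (suc s) = g s
  w : Fin (suc K) → ℤ
  w zero    = + 1
  w (suc s) = - (+ 1)
  C : Fin (suc K) → Matrix (suc m)
  C u = replaceRow A p (A (source u))
  replacedOthers : ∀ u i j → C u (punchIn p i) j ≡ B (punchIn p i) j
  replacedOthers u i j = trans (replaceRow-off A p _ (punchInᵢ≢i p i) j) (sym (others _ (punchInᵢ≢i p i) j))
  expand : ∀ a c → a - c ≡ + 1 * a + - (+ 1) * c
  expand = solve-∀
  replacedRow : ∀ j → B p j ≡ sumFin (λ u → w u * C u p j)
  replacedRow j = trans (rowp j) (trans (expand (A z j) _)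
    (sym (cong₂ _+_ (cong (+ 1 *_) (replaceRow-at A p (A z) j))
      (trans (sumFin-cong (λ s → cong (- (+ 1) *_) (replaceRow-at A p (A (g s)) j)))
             (sym (sumFin-scale (- (+ 1)) (λ s → A (g s) j)))))))
  p≢source : ∀ u → u ≢ suc b → p ≢ source u
  p≢source zero    _   e = z≢p (sym e)
  p≢source (suc s) s≢b e = s≢b (cong suc (sym (g-inj (trans gb≡p e))))
  vanishing : ∀ u → u ≢ suc b → w u * det (C u) ≡ + 0
  vanishing u u≢b = trans (cong (w u *_) (det-equalRows (C u) p (source u) (p≢source u u≢b)
      (λ j → trans (replaceRow-at A p _ j) (sym (replaceRow-off A p _ (λ e → p≢source u u≢b (sym e)) j)))))
    (ℤP.*-zeroʳ (w u))
  restored : ∀ i j → C (suc b) i j ≡ A i j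
  restored i j with i ≟ p
  ... | yes refl = cong (λ r → A r j) gb≡p
  ... | no  _    = refl

↑ˡ≢↑ʳ : ∀ {a b} (x : Fin a) (y : Fin b) → x ↑ˡ b ≢ a ↑ʳ y
↑ˡ≢↑ʳ zero    y ()
↑ˡ≢↑ʳ (suc x) y e = ↑ˡ≢↑ʳ x y (suc-injective e)

punchIn-↑ʳ : ∀ {k l} (s : Fin (suc k)) (x : Fin l) → punchIn (s ↑ˡ l) (k ↑ʳ x) ≡ suc k ↑ʳ x
punchIn-↑ʳ         zero    x = refl
punchIn-↑ʳ {suc k} (suc s) x = cong suc (punchIn-↑ʳ s x)

punchIn-↑ˡ : ∀ {k l} (s : Fin (suc k)) (t : Fin k) → punchIn s t ↑ˡ l ≡ punchIn (s ↑ˡ l) (t ↑ˡ l)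
punchIn-↑ˡ zero    t       = refl
punchIn-↑ˡ (suc s) zero    = refl
punchIn-↑ˡ (suc s) (suc t) = cong suc (punchIn-↑ˡ s t)

-- Expanding along row 0 only the upper columns contribute, and each of their minors is
-- again block lower-triangular with the same lower-right block.
det-blockTriangular : ∀ k {l} (A : Matrix (k +ℕ l)) → (∀ r x → A (r ↑ˡ l) (k ↑ʳ x) ≡ + 0) →
  det A ≡ det (λ r s → A (r ↑ˡ l) (s ↑ˡ l)) * det (λ x y → A (k ↑ʳ x) (k ↑ʳ y))
det-blockTriangular zero    A _ = sym (ℤP.*-identityˡ _)
det-blockTriangular (suc k) {l} A upperRight≡0 = begin
  sumFin (expansionTerm A)
    ≡⟨ sumFin-split (suc k) (expansionTerm A) ⟩
  sumFin (λ s → expansionTerm A (s ↑ˡ l)) + sumFin (λ x → expansionTerm A (suc k ↑ʳ x))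
    ≡⟨ cong₂ _+_ (sumFin-cong upperTerm) (sumFin-zero _ lowerTerm) ⟩
  sumFin (λ s → Lower * expansionTerm Upper s) + + 0
    ≡⟨ ℤP.+-identityʳ _ ⟩
  sumFin (λ s → Lower * expansionTerm Upper s)
    ≡⟨ sym (sumFin-scale Lower (expansionTerm Upper)) ⟩
  Lower * det Upper
    ≡⟨ ℤP.*-comm Lower (det Upper) ⟩
  det Upper * Lower ∎
  where
  open ≡-Reasoning
  Upper : Matrix (suc k)
  Upper r s = A (r ↑ˡ l) (s ↑ˡ l)
  Lower = det (λ x y → A (suc k ↑ʳ x) (suc k ↑ʳ y))
  lowerTerm : ∀ x → expansionTerm A (suc k ↑ʳ x) ≡ + 0
  lowerTerm x = trans (cong (λ a → sgn (toℕ (suc k ↑ʳ x)) * (a * det (minor A (suc k ↑ʳ x))))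
                            (upperRight≡0 zero x))
                      (ℤP.*-zeroʳ (sgn (toℕ (suc k ↑ʳ x))))
  reorder : ∀ g a u d → g * (a * (u * d)) ≡ d * (g * (a * u))
  reorder = solve-∀
  upperTerm : ∀ s → expansionTerm A (s ↑ˡ l) ≡ Lower * expansionTerm Upper s
  upperTerm s = begin
    sgn (toℕ (s ↑ˡ l)) * (A zero (s ↑ˡ l) * det (minor A (s ↑ˡ l)))
      ≡⟨ cong₂ (λ n d → sgn n * (A zero (s ↑ˡ l) * d)) (toℕ-↑ˡ s l)
           (det-blockTriangular k (minor A (s ↑ˡ l))
              (λ r x → trans (cong (A (suc (r ↑ˡ l))) (punchIn-↑ʳ s x)) (upperRight≡0 (suc r) x))) ⟩
    sgn (toℕ s) * (A zero (s ↑ˡ l) * (det (λ r t → minor A (s ↑ˡ l) (r ↑ˡ l) (t ↑ˡ l))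
                                      * det (λ x y → minor A (s ↑ˡ l) (k ↑ʳ x) (k ↑ʳ y))))
      ≡⟨ cong₂ (λ u d → sgn (toℕ s) * (A zero (s ↑ˡ l) * (u * d)))
           (det-cong (λ r t → cong (A (suc (r ↑ˡ l))) (sym (punchIn-↑ˡ s t))))
           (det-cong (λ x y → cong (A (suc (k ↑ʳ x))) (punchIn-↑ʳ s y))) ⟩
    sgn (toℕ s) * (Upper zero s * (det (minor Upper s) * Lower))
      ≡⟨ reorder (sgn (toℕ s)) (Upper zero s) (det (minor Upper s)) Lower ⟩
    Lower * expansionTerm Upper s ∎

∣det-permuteColumns∣ : ∀ {m} {τ : Fin m → Fin m} → RowPermutation τ → ∀ A →
  ∣ det (λ i j → A i (τ j)) ∣ ≡ ∣ det A ∣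
∣det-permuteColumns∣ {τ = τ} π A = begin
  ∣ det (λ i j → A i (τ j)) ∣  ≡⟨ cong ∣_∣ (det-transpose (λ j i → A i (τ j))) ⟩
  ∣ det (λ j i → A i (τ j)) ∣  ≡⟨ ∣det-permute∣ π (λ j i → A i j) ⟩
  ∣ det (λ j i → A i j) ∣      ≡⟨ cong ∣_∣ (det-transpose A) ⟩
  ∣ det A ∣ ∎
  where open ≡-Reasoning

record Factorisation {m} (A : Matrix m) {k} (B : Matrix k) : Set where
  field
    size        : ℕ
    sizes       : k +ℕ size ≡ m
    cofactor    : Matrix size
    entries     : ∀ x y → ∃₂ λ i j → cofactor x y ≡ A i j
    det-factors : ∣ det A ∣ ≡ ∣ det B ∣ *ℕ ∣ det cofactor ∣

-- If the rows f(0), …, f(k-1) of A vanish outside the columns g(0), …, g(k-1), the minor B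
-- on these rows and columns divides det A: permuting rows and columns so that they come
-- first makes A block lower-triangular.
minorFactorisation : ∀ {m k} (A : Matrix m) (f g : Fin k → Fin m) →
  Injective _≡_ _≡_ f → Injective _≡_ _≡_ g → (∀ r q → (∀ s → g s ≢ q) → A (f r) q ≡ + 0) →
  (B : Matrix k) → (∀ r s → A (f r) (g s) ≡ B r s) → Factorisation A B
minorFactorisation A f g f-inj g-inj vanish =
  factorise (ℕP.m+[n∸m]≡n (injective⇒≤ f-inj)) A f g f-inj g-inj vanish
  where
  factorise : ∀ {k l m} → k +ℕ l ≡ m → (A : Matrix m) (f g : Fin k → Fin m) →
    Injective _≡_ _≡_ f → Injective _≡_ _≡_ g → (∀ r q → (∀ s → g s ≢ q) → A (f r) q ≡ + 0) →
    (B : Matrix k) → (∀ r s → A (f r) (g s) ≡ B r s) → Factorisation A B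
  factorise {k} {l} refl A f g f-inj g-inj vanish B minor≗B = record
    { size = l ; sizes = refl ; cofactor = D ; entries = λ x y → _ , _ , refl ; det-factors = factors }
    where
    module F = Extension (extend f f-inj)
    module G = Extension (extend g g-inj)
    P : Matrix (k +ℕ l)
    P x y = A (F.σ x) (G.σ y)
    D : Matrix l
    D x y = P (k ↑ʳ x) (k ↑ʳ y)
    upperRight≡0 : ∀ r x → P (r ↑ˡ l) (k ↑ʳ x) ≡ + 0
    upperRight≡0 r x = trans (cong (λ i → A i (G.σ (k ↑ʳ x))) (F.σ-extends r)) (vanish r _ outside)
      where
      outside : ∀ s → g s ≢ G.σ (k ↑ʳ x)
      outside s e = ↑ˡ≢↑ʳ s x (RowPermutation.rows-injective G.σ-permutation (trans (G.σ-extends s) e))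
    Upper : Matrix k
    Upper r s = P (r ↑ˡ l) (s ↑ˡ l)
    upperLeft : ∀ r s → Upper r s ≡ B r s
    upperLeft r s = trans (cong₂ A (F.σ-extends r) (G.σ-extends s)) (minor≗B r s)
    factors : ∣ det A ∣ ≡ ∣ det B ∣ *ℕ ∣ det D ∣
    factors = begin
      ∣ det A ∣                                          ≡⟨ sym (∣det-permute∣ F.σ-permutation A) ⟩
      ∣ det (λ x j → A (F.σ x) j) ∣                      ≡⟨ sym (∣det-permuteColumns∣ G.σ-permutation _) ⟩
      ∣ det P ∣                                          ≡⟨ cong ∣_∣ (det-blockTriangular k P upperRight≡0) ⟩
      ∣ det Upper * det D ∣                              ≡⟨ ℤP.abs-* (det Upper) (det D) ⟩
      ∣ det Upper ∣ *ℕ ∣ det D ∣                         ≡⟨ cong (λ d → ∣ d ∣ *ℕ ∣ det D ∣) (det-cong upperLeft) ⟩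
      ∣ det B ∣ *ℕ ∣ det D ∣ ∎
      where open ≡-Reasoning

data SplitView (a b : ℕ) : Fin (a +ℕ b) → Set where
  upper : (x : Fin a) → SplitView a b (x ↑ˡ b)
  lower : (y : Fin b) → SplitView a b (a ↑ʳ y)

splitView : ∀ a b (k : Fin (a +ℕ b)) → SplitView a b k
splitView zero    b k       = lower k
splitView (suc a) b zero    = upper zero
splitView (suc a) b (suc k) with splitView a b k
... | upper x = upper (suc x)
... | lower y = lower y

-- The reduced coordinates of Π(c) are indexed by slots: slot c i s is the position of the
-- coordinate x^i_{s+2} of factor i among the sum c reduced coordinates.
slot : ∀ {n} (c : Vec ℕ n) (i : Fin n) → Fin (lookup c i) → Fin (sum c)
slot (c₀ ∷ c) zero    s = s ↑ˡ sum c
slot (c₀ ∷ c) (suc i) s = c₀ ↑ʳ slot c i s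

data SlotView {n} (c : Vec ℕ n) : Fin (sum c) → Set where
  at : (i : Fin n) (s : Fin (lookup c i)) → SlotView c (slot c i s)

slotView : ∀ {n} (c : Vec ℕ n) (q : Fin (sum c)) → SlotView c q
slotView (c₀ ∷ c) q with splitView c₀ (sum c) q
... | upper s = at zero s
... | lower q′ with slotView c q′
...   | at i s = at (suc i) s

slot-factor-injective : ∀ {n} (c : Vec ℕ n) {i i′ s s′} → slot c i s ≡ slot c i′ s′ → i ≡ i′
slot-factor-injective (c₀ ∷ c) {zero}  {zero}   e = refl
slot-factor-injective (c₀ ∷ c) {zero}  {suc i′} e = ⊥-elim (↑ˡ≢↑ʳ _ _ e)
slot-factor-injective (c₀ ∷ c) {suc i} {zero}   e = ⊥-elim (↑ˡ≢↑ʳ _ _ (sym e))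
slot-factor-injective (c₀ ∷ c) {suc i} {suc i′} e = cong suc (slot-factor-injective c (↑ʳ-injective c₀ _ _ e))

slot-injective : ∀ {n} (c : Vec ℕ n) (i : Fin n) {s s′} → slot c i s ≡ slot c i s′ → s ≡ s′
slot-injective (c₀ ∷ c) zero    e = ↑ˡ-injective (sum c) _ _ e
slot-injective (c₀ ∷ c) (suc i) e = slot-injective c i (↑ʳ-injective c₀ _ _ e)

ind : ∀ {k} → Fin k → Fin k → ℤ
ind x y = if does (x ≟ y) then + 1 else + 0

ind-≢ : ∀ {k} {x y : Fin k} → x ≢ y → ind x y ≡ + 0
ind-≢ {x = x} {y} x≢y rewrite dec-false (x ≟ y) x≢y = refl

ind-01 : ∀ {k} (x y : Fin k) → ind x y ≡ + 0 ⊎ ind x y ≡ + 1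
ind-01 x y with does (x ≟ y)
... | true  = inj₂ refl
... | false = inj₁ refl

ind-injective : ∀ {a b} (e : Fin a → Fin b) → Injective _≡_ _≡_ e → ∀ x y → ind (e x) (e y) ≡ ind x y
ind-injective e e-inj x y with x ≟ y
... | yes refl rewrite dec-true (e x ≟ e x) refl = refl
... | no  x≢y  = ind-≢ (λ ex≡ey → x≢y (e-inj ex≡ey))

ind-sum : ∀ {c} (x : Fin (suc c)) → ind x zero + sumFin (λ s → ind x (suc s)) ≡ + 1
ind-sum {zero}  zero    = refl
ind-sum {suc c} zero    =
  cong (_+_ (+ 1)) (sumFin-zero (λ s → ind {suc (suc c)} zero (suc s)) (λ s → ind-≢ (0≢1+n {i = suc s})))
ind-sum {suc c} (suc x) = trans (ℤP.+-identityˡ _) (ind-sum x)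

reduced-slot : ∀ {n} (c : Vec ℕ n) (v : Vertex c) i s → reduced c v (slot c i s) ≡ ind (v i) (suc s)
reduced-slot (c₀ ∷ c) v zero    s rewrite splitAt-↑ˡ c₀ s (sum c)       = refl
reduced-slot (c₀ ∷ c) v (suc i) s rewrite splitAt-↑ʳ c₀ (sum c) (slot c i s) =
  reduced-slot c (λ i → v (suc i)) i s

reduced-cong : ∀ {n} (c : Vec ℕ n) {v w : Vertex c} → (∀ i → v i ≡ w i) →
  ∀ q → reduced c v q ≡ reduced c w q
reduced-cong c {v} {w} v≗w q with slotView c q
... | at i s = trans (reduced-slot c v i s) (trans (cong (λ x → ind x (suc s)) (v≗w i)) (sym (reduced-slot c w i s)))

reduced-01 : ∀ {n} (c : Vec ℕ n) (v : Vertex c) q → reduced c v q ≡ + 0 ⊎ reduced c v q ≡ + 1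
reduced-01 c v q with slotView c q
... | at i s rewrite reduced-slot c v i s = ind-01 (v i) (suc s)

τ : ∀ {c} → Fin (suc c) → Fin (suc c) → Fin (suc c)
τ a zero    = a
τ a (suc t) = if does (suc t ≟ a) then zero else suc t

τ-self : ∀ {c} (a : Fin (suc c)) → τ a a ≡ zero
τ-self zero    = refl
τ-self (suc a) rewrite dec-true (suc a ≟ suc a) refl = refl

τ-fix : ∀ {c} (a : Fin (suc c)) t → suc t ≢ a → τ a (suc t) ≡ suc t
τ-fix a t t+1≢a rewrite dec-false (suc t ≟ a) t+1≢a = refl

τ-involutive : ∀ {c} (a : Fin (suc c)) x → τ a (τ a x) ≡ x
τ-involutive a zero    = τ-self a
τ-involutive a (suc t) with suc t ≟ a
... | yes refl  = refl
... | no  t+1≢a = τ-fix a t t+1≢a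

τ-injective : ∀ {c} (a : Fin (suc c)) → Injective _≡_ _≡_ (τ a)
τ-injective a {x} {y} e = trans (sym (τ-involutive a x)) (trans (cong (τ a) e) (τ-involutive a y))

τ-zero : ∀ {c} (x : Fin (suc c)) → τ zero x ≡ x
τ-zero zero    = refl
τ-zero (suc t) = τ-fix zero t (λ ())

ind-τ : ∀ {c} (a x y : Fin (suc c)) → ind (τ a x) y ≡ ind x (τ a y)
ind-τ a x y = trans (cong (ind (τ a x)) (sym (τ-involutive a y))) (ind-injective (τ a) (τ-injective a) x (τ a y))

ind-τ-fix : ∀ {c} (a x : Fin (suc c)) s → suc s ≢ a → ind (τ a x) (suc s) ≡ ind x (suc s)
ind-τ-fix a x s s+1≢a = trans (ind-τ a x (suc s)) (cong (ind x) (τ-fix a s s+1≢a))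

-- Reduced coordinates with respect to a reference vertex ρ (up to the order of the
-- columns) are the reduced coordinates of the vertices relabelled by τ (ρ i) in each factor.
relabel : ∀ {n} (c : Vec ℕ n) → Vertex c → Vertex c → Vertex c
relabel c ρ v i = τ (ρ i) (v i)

relabelSimplex : ∀ {n} (c : Vec ℕ n) → Vertex c → Simplex c → Simplex c
relabelSimplex c ρ α r = relabel c ρ (α r)

class-cong : ∀ {n} (c : Vec ℕ n) {α β : Simplex c} → (∀ r i → α r i ≡ β r i) → class c α ≡ class c β
class-cong c {α} {β} α≗β = cong ∣_∣ (det-cong {A = classMatrix c α} {B = classMatrix c β}
  λ { r zero → refl ; r (suc q) → reduced-cong c (α≗β r) q })

-- Moving the reference vertex of factor i from vertex a + 1 to vertex 0 negates the
-- determinant: the column of slot (i, a) turns into (column of ones) − Σ_s (column of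
-- slot (i, s)), and all other columns are unchanged.
det-changeReference : ∀ {n} (c : Vec ℕ n) (α : Simplex c) (ρ ρ′ : Vertex c) (i : Fin n) (a : Fin (lookup c i)) →
  ρ i ≡ suc a → ρ′ i ≡ zero → (∀ i′ → i′ ≢ i → ρ′ i′ ≡ ρ i′) →
  det (classMatrix c (relabelSimplex c ρ α)) ≡ - det (classMatrix c (relabelSimplex c ρ′ α))
det-changeReference c α ρ ρ′ i a ρi≡a+1 ρ′i≡0 ρ′≗ρ = begin
  det M                  ≡⟨ sym (det-transpose M) ⟩
  det (λ q r → M r q)    ≡⟨ det-replaceRow (λ q r → M′ r q) (λ q r → M r q) (suc (slot c i a)) zero
                              (λ s → suc (slot c i s)) a
                              (λ e → slot-injective c i (suc-injective e)) refl 0≢1+n others replaced ⟩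
  - det (λ q r → M′ r q) ≡⟨ cong -_ (det-transpose M′) ⟩
  - det M′ ∎
  where
  open ≡-Reasoning
  M M′ : Matrix (suc (sum c))
  M  = classMatrix c (relabelSimplex c ρ α)
  M′ = classMatrix c (relabelSimplex c ρ′ α)
  unchangedSlot : ∀ r i′ s → slot c i′ s ≢ slot c i a →
    M r (suc (slot c i′ s)) ≡ M′ r (suc (slot c i′ s))
  unchangedSlot r i′ s slot≢ with i′ ≟ i
  ... | no  i′≢i = trans (reduced-slot c (relabelSimplex c ρ α r) i′ s)
                   (trans (cong (λ b → ind (τ b (α r i′)) (suc s)) (sym (ρ′≗ρ i′ i′≢i)))
                          (sym (reduced-slot c (relabelSimplex c ρ′ α r) i′ s)))
  ... | yes refl = begin
    M r (suc (slot c i s))                ≡⟨ reduced-slot c (relabelSimplex c ρ α r) i s ⟩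
    ind (τ (ρ i) (α r i)) (suc s)
      ≡⟨ ind-τ-fix (ρ i) (α r i) s (λ e → slot≢ (cong (slot c i) (suc-injective (trans e ρi≡a+1)))) ⟩
    ind (α r i) (suc s)
      ≡⟨ sym (ind-τ-fix (ρ′ i) (α r i) s (λ e → 0≢1+n (trans (sym ρ′i≡0) (sym e)))) ⟩
    ind (τ (ρ′ i) (α r i)) (suc s)        ≡⟨ sym (reduced-slot c (relabelSimplex c ρ′ α r) i s) ⟩
    M′ r (suc (slot c i s)) ∎
  others : ∀ q → q ≢ suc (slot c i a) → ∀ r → M r q ≡ M′ r q
  others zero    _      r = refl
  others (suc q) q≢slot r with slotView c q
  ... | at i′ s = unchangedSlot r i′ s (λ e → q≢slot (cong suc e))
  split : ∀ x S → x ≡ (x + S) - S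
  split = solve-∀
  replaced : ∀ r → M r (suc (slot c i a)) ≡ + 1 - sumFin (λ s → M′ r (suc (slot c i s)))
  replaced r = begin
    M r (suc (slot c i a))                          ≡⟨ reduced-slot c (relabelSimplex c ρ α r) i a ⟩
    ind (τ (ρ i) (α r i)) (suc a)                   ≡⟨ ind-τ (ρ i) (α r i) (suc a) ⟩
    ind (α r i) (τ (ρ i) (suc a))                   ≡⟨ cong (λ b → ind (α r i) (τ b (suc a))) ρi≡a+1 ⟩
    ind (α r i) (τ (suc a) (suc a))                 ≡⟨ cong (ind (α r i)) (τ-self (suc a)) ⟩
    ind (α r i) zero                                ≡⟨ split (ind (α r i) zero) _ ⟩
    (ind (α r i) zero + sumFin (λ s → ind (α r i) (suc s))) - sumFin (λ s → ind (α r i) (suc s))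
      ≡⟨ cong₂ _-_ (ind-sum (α r i)) (sumFin-cong (λ s → sym (trans (reduced-slot c (relabelSimplex c ρ′ α r) i s)
           (ind-τ-fix (ρ′ i) (α r i) s (λ e → 0≢1+n (trans (sym ρ′i≡0) (sym e))))))) ⟩
    + 1 - sumFin (λ s → M′ r (suc (slot c i s))) ∎

reset : ∀ {n} (c : Vec ℕ n) → Vertex c → Fin n → Vertex c
reset c ρ i₀ i = if does (i ≟ i₀) then zero else ρ i

reset-at : ∀ {n} (c : Vec ℕ n) ρ i₀ → reset c ρ i₀ i₀ ≡ zero
reset-at c ρ i₀ rewrite dec-true (i₀ ≟ i₀) refl = refl

reset-off : ∀ {n} (c : Vec ℕ n) ρ i₀ i → i ≢ i₀ → reset c ρ i₀ i ≡ ρ i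
reset-off c ρ i₀ i i≢i₀ rewrite dec-false (i ≟ i₀) i≢i₀ = refl

class-reset : ∀ {n} (c : Vec ℕ n) (α : Simplex c) (ρ : Vertex c) (i₀ : Fin n) →
  class c (relabelSimplex c ρ α) ≡ class c (relabelSimplex c (reset c ρ i₀) α)
class-reset c α ρ i₀ with ρ i₀ in ρi₀≡
... | zero  = class-cong c (λ r i → cong (λ b → τ b (α r i)) (ρ≗reset i))
  where
  ρ≗reset : ∀ i → ρ i ≡ reset c ρ i₀ i
  ρ≗reset i with i ≟ i₀
  ... | yes refl = ρi₀≡
  ... | no  _    = refl
... | suc a =
  trans (cong ∣_∣ (det-changeReference c α ρ (reset c ρ i₀) i₀ a ρi₀≡ (reset-at c ρ i₀) (reset-off c ρ i₀)))
                    (ℤP.∣-i∣≡∣i∣ (det (classMatrix c (relabelSimplex c (reset c ρ i₀) α))))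

-- The class does not depend on the reference vertex: reset the factors k-1, …, 0 one by one.
class-referenceFree : ∀ {n} (c : Vec ℕ n) (α : Simplex c) k (ρ : Vertex c) → (∀ i → k ≤ toℕ i → ρ i ≡ zero) →
  class c (relabelSimplex c ρ α) ≡ class c α
class-referenceFree c α zero ρ ρ≡0 =
  class-cong c (λ r i → trans (cong (λ b → τ b (α r i)) (ρ≡0 i z≤n)) (τ-zero (α r i)))
class-referenceFree {n} c α (suc k) ρ ρ≡0 with k <? n
... | no  k≮n = class-referenceFree c α k ρ (λ i k≤i → ⊥-elim (k≮n (ℕP.≤-<-trans k≤i (toℕ<n i))))
... | yes k<n = trans (class-reset c α ρ (fromℕ< k<n)) (class-referenceFree c α k (reset c ρ (fromℕ< k<n)) reset≡0)
  where
  reset≡0 : ∀ i → k ≤ toℕ i → reset c ρ (fromℕ< k<n) i ≡ zero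
  reset≡0 i k≤i with i ≟ fromℕ< k<n
  ... | yes _   = refl
  ... | no  i≢k =
    ρ≡0 i (ℕP.≤∧≢⇒< k≤i (λ k≡i → i≢k (toℕ-injective (trans (sym k≡i) (sym (toℕ-fromℕ< k<n))))))

class-referenceIndependent : ∀ {n} (c : Vec ℕ n) (α : Simplex c) (ρ : Vertex c) →
  class c (relabelSimplex c ρ α) ≡ class c α
class-referenceIndependent {n} c α ρ =
  class-referenceFree c α n ρ (λ i n≤i → ⊥-elim (ℕP.<⇒≱ (toℕ<n i) n≤i))

slotMap : ∀ {n} (d c : Vec ℕ n) → ((i : Fin n) → Fin (lookup d i) → Fin (lookup c i)) →
  Fin (sum d) → Fin (sum c)
slotMap (d₀ ∷ d) (c₀ ∷ c) h q with splitAt d₀ q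
... | inj₁ s  = h zero s ↑ˡ sum c
... | inj₂ q′ = c₀ ↑ʳ slotMap d c (λ i → h (suc i)) q′

slotMap-slot : ∀ {n} (d c : Vec ℕ n) h i s → slotMap d c h (slot d i s) ≡ slot c i (h i s)
slotMap-slot (d₀ ∷ d) (c₀ ∷ c) h zero    s rewrite splitAt-↑ˡ d₀ s (sum d) = refl
slotMap-slot (d₀ ∷ d) (c₀ ∷ c) h (suc i) s rewrite splitAt-↑ʳ d₀ (sum d) (slot d i s) =
  cong (c₀ ↑ʳ_) (slotMap-slot d c (λ i → h (suc i)) i s)

slotMap-injective : ∀ {n} (d c : Vec ℕ n) h → (∀ i → Injective _≡_ _≡_ (h i)) →
  Injective _≡_ _≡_ (slotMap d c h)
slotMap-injective d c h h-inj {q} {q′} e with slotView d q | slotView d q′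
... | at i s | at i′ s′ = sameSlot (trans (sym (slotMap-slot d c h i s)) (trans e (slotMap-slot d c h i′ s′)))
  where
  sameSlot : ∀ {i i′ s s′} → slot c i (h i s) ≡ slot c i′ (h i′ s′) → slot d i s ≡ slot d i′ s′
  sameSlot {i} e′ with slot-factor-injective c e′
  ... | refl = cong (slot d i) (h-inj i (slot-injective c i e′))

-- The face of Δ^c spanned by the vertices e(0), …, e(d), seen from the vertex e(0):
-- vertex e(s+1) is relabelled to a vertex faceSlot s + 1 of Δ^c.
module _ {d₀ c₀ : ℕ} (e : Fin (suc d₀) → Fin (suc c₀)) (e-inj : Injective _≡_ _≡_ e) where

  private
    nonzero : ∀ s → zero ≢ τ (e zero) (e (suc s))
    nonzero s τe≡0 = 0≢1+n (sym (e-inj (τ-injective (e zero) (trans (sym τe≡0) (sym (τ-self (e zero)))))))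

  faceSlot : Fin d₀ → Fin c₀
  faceSlot s = punchOut (nonzero s)

  suc-faceSlot : ∀ s → suc (faceSlot s) ≡ τ (e zero) (e (suc s))
  suc-faceSlot s = punchIn-punchOut (nonzero s)

  faceSlot-injective : Injective _≡_ _≡_ faceSlot
  faceSlot-injective {s} {s′} eq =
    suc-injective (e-inj (τ-injective (e zero) (trans (sym (suc-faceSlot s)) (trans (cong suc eq) (suc-faceSlot s′)))))

  faceSlot-onto : ∀ x t → τ (e zero) (e x) ≡ suc t → Σ (Fin d₀) λ s → faceSlot s ≡ t
  faceSlot-onto zero    t eq = ⊥-elim (0≢1+n (trans (sym (τ-self (e zero))) eq))
  faceSlot-onto (suc s) t eq = s , suc-injective (trans (suc-faceSlot s) eq)

module _ {n} {d c : Vec ℕ n} (G : FaceEmbedding d c) where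
  open FaceEmbedding G

  faceReference : Vertex c
  faceReference i = emb i zero

  faceColumn : Fin (sum d) → Fin (sum c)
  faceColumn = slotMap d c (λ i → faceSlot (emb i) (emb-injective i))

  faceColumn-injective : Injective _≡_ _≡_ faceColumn
  faceColumn-injective = slotMap-injective d c _ (λ i → faceSlot-injective (emb i) (emb-injective i))

  faceCoordinate : (w : Vertex d) (v : Vertex c) → (∀ i → emb i (w i) ≡ v i) →
    ∀ q → reduced c (relabel c faceReference v) (faceColumn q) ≡ reduced d w q
  faceCoordinate w v v≡emb-w q with slotView d q
  ... | at i s = begin
    reduced c (relabel c faceReference v) (faceColumn (slot d i s))
      ≡⟨ cong (reduced c (relabel c faceReference v)) (slotMap-slot d c _ i s) ⟩
    reduced c (relabel c faceReference v) (slot c i (faceSlot (emb i) (emb-injective i) s))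
      ≡⟨ reduced-slot c _ i _ ⟩
    ind (τ (emb i zero) (v i)) (suc (faceSlot (emb i) (emb-injective i) s))
      ≡⟨ cong₂ (λ x y → ind (τ (emb i zero) x) y)
               (sym (v≡emb-w i)) (suc-faceSlot (emb i) (emb-injective i) s) ⟩
    ind (τ (emb i zero) (emb i (w i))) (τ (emb i zero) (emb i (suc s)))
      ≡⟨ ind-injective (λ x → τ (emb i zero) (emb i x))
                       (λ eq → emb-injective i (τ-injective (emb i zero) eq)) (w i) (suc s) ⟩
    ind (w i) (suc s)
      ≡⟨ sym (reduced-slot d w i s) ⟩
    reduced d w (slot d i s) ∎
    where open ≡-Reasoning

  faceCoordinate-outside : (w : Vertex d) (v : Vertex c) → (∀ i → emb i (w i) ≡ v i) →
    ∀ q′ → (∀ q → faceColumn q ≢ q′) → reduced c (relabel c faceReference v) q′ ≡ + 0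
  faceCoordinate-outside w v v≡emb-w q′ outside with slotView c q′
  ... | at i t with τ (emb i zero) (v i) ≟ suc t
  ...   | no  τv≢t+1 = trans (reduced-slot c _ i t) (ind-≢ τv≢t+1)
  ...   | yes τv≡t+1
    with faceSlot-onto (emb i) (emb-injective i) (w i) t (trans (cong (τ (emb i zero)) (v≡emb-w i)) τv≡t+1)
  ...     | s , faceSlot≡t =
    ⊥-elim (outside (slot d i s) (trans (slotMap-slot d c _ i s) (cong (slot c i) faceSlot≡t)))

classMatrix-01 : ∀ {n} (c : Vec ℕ n) (α : Simplex c) r q →
  classMatrix c α r q ≡ + 0 ⊎ classMatrix c α r q ≡ + 1
classMatrix-01 c α r zero    = inj₂ refl
classMatrix-01 c α r (suc q) = reduced-01 c (α r) q

module _ {n} {c : Vec ℕ n} {α : Simplex c} {d : Vec ℕ n} {G : FaceEmbedding d c}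
         {f : Fin (suc (sum d)) → Fin (suc (sum c))} {β : Simplex d} (ext : IsExteriorFace c α d G f β) where
  open FaceEmbedding G
  open IsExteriorFace ext

  private
    A : Matrix (suc (sum c))
    A = classMatrix c (relabelSimplex c (faceReference G) α)

    faceColumns : Fin (suc (sum d)) → Fin (suc (sum c))
    faceColumns zero    = zero
    faceColumns (suc q) = suc (faceColumn G q)

    faceColumns-injective : Injective _≡_ _≡_ faceColumns
    faceColumns-injective {zero}  {zero}  _ = refl
    faceColumns-injective {suc q} {suc q′} e = cong suc (faceColumn-injective G (suc-injective e))

    vanish : ∀ r q → (∀ s → faceColumns s ≢ q) → A (f r) q ≡ + 0
    vanish r zero    outside = ⊥-elim (outside zero refl)
    vanish r (suc q) outside =
      faceCoordinate-outside G (β r) (α (f r)) (vertices-agree r) q (λ s e → outside (suc s) (cong suc e))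

    agree : ∀ r s → A (f r) (faceColumns s) ≡ classMatrix d β r s
    agree r zero    = refl
    agree r (suc q) = faceCoordinate G (β r) (α (f r)) (vertices-agree r) q

  exteriorFace-factorisation : Factorisation A (classMatrix d β)
  exteriorFace-factorisation =
    minorFactorisation A f faceColumns f-injective faceColumns-injective vanish (classMatrix d β) agree

  open Factorisation exteriorFace-factorisation

  exteriorFace-class : class c α ≡ class d β *ℕ ∣ det cofactor ∣
  exteriorFace-class = trans (sym (class-referenceIndependent c α (faceReference G))) det-factors

  exteriorFacet-cofactor : suc (sum d) ≡ sum c → ∣ det cofactor ∣ ≡ 0 ⊎ ∣ det cofactor ∣ ≡ 1
  exteriorFacet-cofactor facet = oneByOne cofactor size≡1 entries01
    where
    size≡1 : size ≡ 1
    size≡1 = ℕP.+-cancelˡ-≡ (suc (sum d)) size 1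
               (trans sizes (trans (cong suc (sym facet)) (ℕP.+-comm 1 (suc (sum d)))))
    entries01 : ∀ x y → cofactor x y ≡ + 0 ⊎ cofactor x y ≡ + 1
    entries01 x y with entries x y
    ... | i , j , D≡A rewrite D≡A = classMatrix-01 c _ i j
    oneByOne : ∀ {l} (D : Matrix l) → l ≡ 1 → (∀ x y → D x y ≡ + 0 ⊎ D x y ≡ + 1) →
      ∣ det D ∣ ≡ 0 ⊎ ∣ det D ∣ ≡ 1
    oneByOne D refl D01 with D01 zero zero
    ... | inj₁ D≡0 rewrite D≡0 = inj₁ refl
    ... | inj₂ D≡1 rewrite D≡1 = inj₂ refl

proposition7 : ∀ {n} (c : Vec ℕ n) (α : Simplex c) → NonDegenerate c α →
    (∀ (d : Vec ℕ n) (G : FaceEmbedding d c) (f : Fin (suc (sum d)) → Fin (suc (sum c)))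
       (β : Simplex d) → IsExteriorFace c α d G f β → class d β ∣ class c α)
    × (∀ (d : Vec ℕ n) (G : FaceEmbedding d c) (f : Fin (suc (sum d)) → Fin (suc (sum c)))
       (β : Simplex d) → IsExteriorFace c α d G f β → suc (sum d) ≡ sum c →
       class d β ≡ class c α)
proposition7 c α nondegenerate = faceDivides , facetEqual
  where
  faceDivides : ∀ d G f β → IsExteriorFace c α d G f β → class d β ∣ class c α
  faceDivides d G f β ext =
    divides ∣ det cofactor ∣ (trans (exteriorFace-class ext) (ℕP.*-comm (class d β) ∣ det cofactor ∣))
    where open Factorisation (exteriorFace-factorisation ext)
  facetEqual : ∀ d G f β → IsExteriorFace c α d G f β → suc (sum d) ≡ sum c → class d β ≡ class c α
  facetEqual d G f β ext facet with exteriorFacet-cofactor ext facet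
  ... | inj₁ cofactor≡0 = ⊥-elim (nondegenerate (trans (exteriorFace-class ext)
                            (trans (cong (class d β *ℕ_) cofactor≡0) (ℕP.*-zeroʳ (class d β)))))
  ... | inj₂ cofactor≡1 = sym (trans (exteriorFace-class ext)
                            (trans (cong (class d β *ℕ_) cofactor≡1) (ℕP.*-identityʳ (class d β))))
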